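{- Let $L$ be a finite geometric lattice with the minimal labeling $\lambda$ induced by some total ordering of its atoms. Then the directed graph $G_{lex}$ is exactly the Hasse diagram of the maximal chain descent order $L_\lambda(2)$; that is, for maximal chains $M,M'$ of $L$, there is a directed edge $M\to M'$ in $G_{lex}$ if and only if $M'$ is covered by $M$ in $L_\lambda(2)$.
   Context: A finite lattice is geometric if it is atomic and semimodular; it is graded. For $u\in L$ let $A(u)$ be the set of atoms below $u$. The minimal labeling induced by a total order on atoms assigns to $u\lessdot v$ the label $\lambda(u,v)=\min(A(v)\setminus A(u))$; it is an EL-labeling, so every interval $[u,w]$ has a unique saturated chain with weakly increasing labels (the ascending chain of $[u,w]$). For a maximal chain $M=(\hat0=x_0\lessdot\cdots\lessdot x_r=\hat1)$ with a descent at rank $i$ (i.e. $\lambda(x_{i-1},x_i)>\lambda(x_i,x_{i+1})$), a polygon move takes $M$ to the maximal chain obtained by replacing $x_i$ with the ascending chain of $[x_{i-1},x_{i+1}]$. $G_{lex}$ is the directed graph on the maximal chains of $L$ with an edge $M\to M'$ whenever $M'$ is obtained from $M$ by such a replacement at a descent. The maximal chain descent order $L_\lambda(2)$ is the partial order on maximal chains of $L$ obtained as the reflexive-transitive closure of the relations $M'\le M$ whenever $M'$ is obtained from $M$ by a polygon move. -}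

module Defs where

open import Data.Nat using (ℕ; _<_) renaming (_≤_ to _≤ℕ_)
open import Data.Fin using (Fin)
open import Data.List using (List; []; _∷_; _++_)
open import Data.Product using (_×_; ∃; ∃-syntax; _,_)
open import Data.Unit using () renaming (⊤ to Unit)
open import Relation.Nullary using (¬_)
open import Relation.Binary.PropositionalEquality using (_≡_; _≢_)
open import Relation.Binary.Lattice.Structures using (IsBoundedLattice)
open import Relation.Binary.Construct.Closure.ReflexiveTransitive using (Star)

-- A finite (bounded) lattice, with carrier Fin n (every finite lattice is
-- isomorphic to one of this form); equality is propositional equality.
record FinLattice : Set₁ where
  field
    n   : ℕ
    _≤_ : Fin n → Fin n → Set
    _∨_ : Fin n → Fin n → Fin n
    _∧_ : Fin n → Fin n → Fin n
    top : Fin n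
    bot : Fin n
    isBoundedLattice : IsBoundedLattice _≡_ _≤_ _∨_ _∧_ top bot

module _ (L : FinLattice) where
  open FinLattice L

  Elt : Set
  Elt = Fin n

  _<L_ : Elt → Elt → Set
  x <L y = (x ≤ y) × (x ≢ y)

  _⋖_ : Elt → Elt → Set
  x ⋖ y = (x <L y) × (∀ z → x <L z → z <L y → Data.Empty.⊥)
    where import Data.Empty

  Atom : Elt → Set
  Atom a = bot ⋖ a

  Atomic : Set
  Atomic = ∀ x u → (∀ a → Atom a → a ≤ x → a ≤ u) → x ≤ u

  Semimodular : Set
  Semimodular = ∀ x y → (x ∧ y) ⋖ x → y ⋖ (x ∨ y)

  Geometric : Set
  Geometric = Atomic × Semimodular

  -- A total order on the atoms, given as a map to ℕ injective on atoms
  AtomOrder : (Elt → ℕ) → Set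
  AtomOrder ω = ∀ a b → Atom a → Atom b → ω a ≡ ω b → a ≡ b

  -- saturated chains u = x₀ ⋖ x₁ ⋖ ... ⋖ x_k = w, listed as x₀ ∷ ... ∷ x_k
  data SatChain : Elt → Elt → List Elt → Set where
    done : ∀ {u} → SatChain u u (u ∷ [])
    step : ∀ {u v w xs} → u ⋖ v → SatChain v w xs → SatChain u w (u ∷ xs)

  MaxChain : List Elt → Set
  MaxChain xs = SatChain bot top xs

  module Labeling (ω : Elt → ℕ) where

    -- Label u v ℓ : ℓ = λ(u,v) = min ω-value of A(v) \ A(u)   (for u ⋖ v)
    Label : Elt → Elt → ℕ → Set
    Label u v ℓ =
      (∃[ a ] (Atom a × a ≤ v × ¬ (a ≤ u) × ω a ≡ ℓ))
      × (∀ b → Atom b → b ≤ v → ¬ (b ≤ u) → ℓ ≤ℕ ω b)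

    Ascending : List Elt → Set
    Ascending (x ∷ y ∷ z ∷ rest) =
      (∀ ℓ₁ ℓ₂ → Label x y ℓ₁ → Label y z ℓ₂ → ℓ₁ ≤ℕ ℓ₂) × Ascending (y ∷ z ∷ rest)
    Ascending _ = Unit

    Descent : Elt → Elt → Elt → Set
    Descent x y z = ∃[ ℓ₁ ] ∃[ ℓ₂ ] (Label x y ℓ₁ × Label y z ℓ₂ × ℓ₂ < ℓ₁)

    -- edge M → M' of G_lex: polygon move at a descent of the maximal chain M,
    -- replacing x_{i} by the ascending chain C of [x_{i-1}, x_{i+1}]
    PolygonMove : List Elt → List Elt → Set
    PolygonMove M M' =
      MaxChain M ×
      (∃[ pre ] ∃[ post ] ∃[ x ] ∃[ y ] ∃[ z ] ∃[ C ]
        ( M ≡ pre ++ (x ∷ y ∷ z ∷ post)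
        × Descent x y z
        × SatChain x z C
        × Ascending C
        × M' ≡ pre ++ C ++ post))

    -- maximal chain descent order L_λ(2):  M' ≤ M  iff M' is reached from M
    -- by a finite sequence of polygon moves
    _≤D_ : List Elt → List Elt → Set
    M' ≤D M = Star PolygonMove M M'

    _<D_ : List Elt → List Elt → Set
    M' <D M = (M' ≤D M) × (M' ≢ M)

    CoveredBy : List Elt → List Elt → Set
    CoveredBy M' M =
      (M' <D M) × (∀ N → MaxChain N → M' <D N → N <D M → Data.Empty.⊥)
      where import Data.Empty

-- Order the elements of L lexicographically by their atom sets: F ≺ G when the
-- ω-least atom lying below exactly one of F and G lies below F.  If x ⋖ y ⋖ z is a
-- descent, the ascending chain of [x, z] has length two by semimodularity, x ⋖ w ⋖ z,
-- and its first label is the least label of [x, z], hence smaller than λ(x, y);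
-- this makes w ≺ y.  So a polygon move lowers exactly one entry of a maximal chain
-- and L_λ(2) is contained in the pointwise order induced by ≺.  If M → M' and
-- M → N ⇝ M', comparing pointwise forces both moves to act at the same rank,
-- where the ascending chain is unique, so N = M': a single move is a cover.
-- Conversely a composite of two or more moves is never a cover.
module Submission where

open import Defs hiding (_⋖_; Atom)
open import Data.Nat using (ℕ)
open import Data.List using (List)
open import Data.Product using (_×_)

open import Level using (0ℓ)
open import Function using (_∘_)
open import Data.Nat as ℕ using (_<_) renaming (_≤_ to _≤ℕ_)
import Data.Nat.Properties as ℕ
open import Data.Fin using (Fin) renaming (_≟_ to _≟ᶠ_)
open import Data.Fin.Properties using (any?; all?)
open import Data.List using ([]; _∷_; _++_; _∷ʳ_; filter; allFin)
open import Data.List.Properties using (∷-injective; ∷ʳ-injective; ++-assoc)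
open import Data.List.Extrema.Nat using (argmin; argmin-all; f[argmin]≤f[xs])
open import Data.List.Membership.Propositional.Properties using (∈-filter⁺; ∈-allFin)
open import Data.List.Relation.Unary.All as All using ()
open import Data.List.Relation.Unary.All.Properties using (all-filter)
open import Data.List.Relation.Binary.Pointwise as Pointwise using (Pointwise; _∷_; Pointwise-≡⇒≡)
open import Data.Product using (∃; ∃-syntax; _,_; proj₁; proj₂; map₁)
open import Data.Sum using (_⊎_; inj₁; inj₂)
open import Data.Empty using (⊥; ⊥-elim)
open import Relation.Nullary using (¬_; yes; no)
open import Relation.Nullary.Decidable using (_×-dec_; _→-dec_; ¬?; map′; decidable-stable)
open import Relation.Unary as U using (Pred)
open import Relation.Binary using (Rel; Decidable; IsStrictPartialOrder; IsPartialOrder; tri<; tri≈; tri>)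
import Relation.Binary.Construct.StrictToNonStrict as StrictToNonStrict
open import Relation.Binary.PropositionalEquality
open import Relation.Binary.Construct.Closure.ReflexiveTransitive using (ε; _◅_; _◅◅_)
open import Relation.Binary.Lattice.Structures using (IsBoundedLattice)

module PointwiseOrder {a ℓ} {A : Set a} {_<ᴬ_ : Rel A ℓ}
                      (<-isStrictPartialOrder : IsStrictPartialOrder _≡_ _<ᴬ_) where
  open IsStrictPartialOrder <-isStrictPartialOrder using (irrefl; asym)
  open StrictToNonStrict _≡_ _<ᴬ_ using (_≤_)

  infix 4 _≤*_
  _≤*_ : Rel (List A) _
  _≤*_ = Pointwise _≤_

  private
    module ≤* = IsPartialOrder
      (Pointwise.isPartialOrder (StrictToNonStrict.isPartialOrder _≡_ _<ᴬ_ <-isStrictPartialOrder))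

  ≤*-refl : ∀ {xs} → xs ≤* xs
  ≤*-refl = ≤*.refl

  ≤*-trans : ∀ {xs ys zs} → xs ≤* ys → ys ≤* zs → xs ≤* zs
  ≤*-trans = ≤*.trans

  ≤*-antisym : ∀ {xs ys} → xs ≤* ys → ys ≤* xs → xs ≡ ys
  ≤*-antisym p q = Pointwise-≡⇒≡ (≤*.antisym p q)

  <⇒≱ : ∀ {w y} → w <ᴬ y → ¬ y ≤ w
  <⇒≱ w<y (inj₁ y<w) = asym w<y y<w
  <⇒≱ w<y (inj₂ refl) = irrefl refl w<y

  replace-<⇒≤* : ∀ pre {post w y} → w <ᴬ y → pre ++ w ∷ post ≤* pre ++ y ∷ post
  replace-<⇒≤* pre w<y = Pointwise.++⁺ ≤*-refl (inj₁ w<y ∷ ≤*-refl)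

  replace-<⇒≱* : ∀ pre {post w y} → w <ᴬ y → ¬ pre ++ y ∷ post ≤* pre ++ w ∷ post
  replace-<⇒≱* pre w<y le = <⇒≱ w<y (Pointwise.head (Pointwise.++-cancelˡ pre le))

  replaced-position-unique : ∀ pre pre' {post post' y y' w w'} →
    pre ++ y ∷ post ≡ pre' ++ y' ∷ post' → w <ᴬ y →
    pre' ++ w' ∷ post' ≤* pre ++ w ∷ post → pre ≡ pre' × y ≡ y' × post ≡ post'
  replaced-position-unique [] [] refl _ _ = refl , refl , refl
  replaced-position-unique [] (_ ∷ _) refl w<y (y≤w ∷ _) = ⊥-elim (<⇒≱ w<y y≤w)
  replaced-position-unique (_ ∷ pre) [] refl w<y (_ ∷ le) = ⊥-elim (replace-<⇒≱* pre w<y le)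
  replaced-position-unique (a ∷ pre) (_ ∷ pre') eq w<y (_ ∷ le) with refl , eq′ ← ∷-injective eq =
    map₁ (cong (a ∷_)) (replaced-position-unique pre pre' eq′ w<y le)

argmin-exists : ∀ {n p} {P : Pred (Fin n) p} → U.Decidable P → (f : Fin n → ℕ) →
                ∀ {a} → P a → ∃[ m ] (P m × ∀ b → P b → f m ≤ℕ f b)
argmin-exists {n} {P = P} P? f {a} Pa = m , argmin-all f Pa (all-filter P? (allFin n)) , minimal
  where
  m : Fin n
  m = argmin f a (filter P? (allFin n))
  minimal : ∀ b → P b → f m ≤ℕ f b
  minimal b Pb = All.lookup (f[argmin]≤f[xs] a _) (∈-filter⁺ P? (∈-allFin b) Pb)

module LatticeFacts (L : FinLattice) where
  open FinLattice L
  open IsBoundedLattice isBoundedLattice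
    using (x≤x∨y; y≤x∨y; ∨-least; x∧y≤x; x∧y≤y; ∧-greatest)
    renaming (refl to ≤-refl; trans to ≤-trans; antisym to ≤-antisym)

  infix 4 _⋖_
  _⋖_ : Elt L → Elt L → Set
  _⋖_ = Defs._⋖_ L

  Atom : Elt L → Set
  Atom = Defs.Atom L

  NewAtom : Elt L → Elt L → Elt L → Set
  NewAtom u v a = Atom a × a ≤ v × ¬ a ≤ u

  private variable
    ℓ : ℕ
    c e u v w x y z : Elt L
    xs C : List (Elt L)

  _≤?_ : Decidable _≤_
  x ≤? y = map′ (λ eq → subst (_≤ y) eq (x∧y≤y x y))
                (λ x≤y → ≤-antisym (x∧y≤x x y) (∧-greatest ≤-refl x≤y))
                ((x ∧ y) ≟ᶠ x)

  _<?_ : Decidable (_<L_ L)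
  x <? y = (x ≤? y) ×-dec ¬? (x ≟ᶠ y)

  atom? : U.Decidable Atom
  atom? a = (bot <? a) ×-dec all? (λ z → bot <? z →-dec (z <? a →-dec no (λ ())))

  newAtom? : ∀ u v → U.Decidable (NewAtom u v)
  newAtom? u v a = atom? a ×-dec (a ≤? v) ×-dec ¬? (a ≤? u)

  ⋖⇒≤ : x ⋖ y → x ≤ y
  ⋖⇒≤ = proj₁ ∘ proj₁

  ⋖⇒≢ : x ⋖ y → x ≢ y
  ⋖⇒≢ = proj₂ ∘ proj₁

  ⋖-between : x ⋖ y → x ≤ z → z ≤ y → x ≡ z ⊎ z ≡ y
  ⋖-between {x} {y} {z} x⋖y x≤z z≤y with x ≟ᶠ z | z ≟ᶠ y
  ... | yes x≡z | _       = inj₁ x≡z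
  ... | no _    | yes z≡y = inj₂ z≡y
  ... | no x≢z  | no z≢y  = ⊥-elim (proj₂ x⋖y z (x≤z , x≢z) (z≤y , z≢y))

  ⋖-join : x ⋖ w → c ≤ w → ¬ c ≤ x → x ∨ c ≡ w
  ⋖-join {x} {w} {c} x⋖w c≤w c≰x with ⋖-between x⋖w (x≤x∨y x c) (∨-least (⋖⇒≤ x⋖w) c≤w)
  ... | inj₁ x≡x∨c = ⊥-elim (c≰x (subst (c ≤_) (sym x≡x∨c) (y≤x∨y x c)))
  ... | inj₂ x∨c≡w = x∨c≡w

  SatChain⇒≤ : SatChain L u w xs → u ≤ w
  SatChain⇒≤ done = ≤-refl
  SatChain⇒≤ (step u⋖v chain) = ≤-trans (⋖⇒≤ u⋖v) (SatChain⇒≤ chain)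

  SatChain-⋖ : ∀ pre → SatChain L u w (pre ++ x ∷ y ∷ xs) → x ⋖ y
  SatChain-⋖ [] (step x⋖y done) = x⋖y
  SatChain-⋖ [] (step x⋖y (step _ _)) = x⋖y
  SatChain-⋖ (_ ∷ []) (step _ chain) = SatChain-⋖ [] chain
  SatChain-⋖ (_ ∷ p ∷ pre) (step _ chain) = SatChain-⋖ (p ∷ pre) chain

  SatChain-trivial : SatChain L v v xs → xs ≡ v ∷ []
  SatChain-trivial done = refl
  SatChain-trivial (step v⋖u chain) = ⊥-elim (⋖⇒≢ v⋖u (≤-antisym (⋖⇒≤ v⋖u) (SatChain⇒≤ chain)))

  SatChain-cover : u ⋖ z → SatChain L u z xs → xs ≡ u ∷ z ∷ []
  SatChain-cover u⋖z done = ⊥-elim (⋖⇒≢ u⋖z refl)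
  SatChain-cover u⋖z (step u⋖v chain) with ⋖-between u⋖z (⋖⇒≤ u⋖v) (SatChain⇒≤ chain)
  ... | inj₁ u≡v  = ⊥-elim (⋖⇒≢ u⋖v u≡v)
  ... | inj₂ refl = cong (_ ∷_) (SatChain-trivial chain)

  module Semimodularity (semimodular : Semimodular L) where

    ⋖-diamond : x ⋖ y → y ⋖ z → x ⋖ u → u ≤ z → u ⋖ z
    ⋖-diamond {x} {y} {z} {u} x⋖y y⋖z x⋖u u≤z with u ≟ᶠ y
    ... | yes refl = y⋖z
    ... | no u≢y = subst (u ⋖_) y∨u≡z (semimodular y u (subst (_⋖ y) (sym y∧u≡x) x⋖y))
      where
      u≰y : ¬ u ≤ y
      u≰y u≤y = proj₂ x⋖y u (proj₁ x⋖u) (u≤y , u≢y)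
      y∧u≡x : y ∧ u ≡ x
      y∧u≡x with ⋖-between x⋖u (∧-greatest (⋖⇒≤ x⋖y) (⋖⇒≤ x⋖u)) (x∧y≤y y u)
      ... | inj₁ x≡y∧u = sym x≡y∧u
      ... | inj₂ y∧u≡u = ⊥-elim (u≰y (subst (_≤ y) y∧u≡u (x∧y≤x y u)))
      y∨u≡z : y ∨ u ≡ z
      y∨u≡z with ⋖-between y⋖z (x≤x∨y y u) (∨-least (⋖⇒≤ y⋖z) u≤z)
      ... | inj₁ y≡y∨u = ⊥-elim (u≰y (subst (u ≤_) (sym y≡y∨u) (y≤x∨y y u)))
      ... | inj₂ y∨u≡z = y∨u≡z

    SatChain-length-two : x ⋖ y → y ⋖ z → SatChain L x z C →
                          ∃[ w ] (C ≡ x ∷ w ∷ z ∷ [] × x ⋖ w × w ⋖ z)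
    SatChain-length-two x⋖y y⋖z done = ⊥-elim (⋖⇒≢ x⋖y (≤-antisym (⋖⇒≤ x⋖y) (⋖⇒≤ y⋖z)))
    SatChain-length-two {z = z} x⋖y y⋖z (step {v = w} x⋖w chain) =
      w , cong (_ ∷_) (SatChain-cover w⋖z chain) , x⋖w , w⋖z
      where
      w⋖z : w ⋖ z
      w⋖z = ⋖-diamond x⋖y y⋖z x⋖w (SatChain⇒≤ chain)

  module MinimalLabeling (ω : Elt L → ℕ) where
    open Labeling L ω

    below-label⇒≤ : Label u v ℓ → Atom e → ω e < ℓ → e ≤ v → e ≤ u
    below-label⇒≤ {u} {e = e} (_ , minimal) e-atom ωe<ℓ e≤v =
      decidable-stable (e ≤? u) (λ e≰u → ℕ.<⇒≱ ωe<ℓ (minimal e e-atom e≤v e≰u))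

    AscendingMiddle : Elt L → Elt L → Elt L → Set
    AscendingMiddle x z w = x ⋖ w × w ⋖ z × Ascending (x ∷ w ∷ z ∷ [])

    SameAtomsBelow : Elt L → Elt L → ℕ → Set
    SameAtomsBelow F G k = ∀ e → Atom e → ω e < k → (e ≤ F → e ≤ G) × (e ≤ G → e ≤ F)

    SameAtomsBelow-trans : ∀ {F G H k} → SameAtomsBelow F G k → SameAtomsBelow G H k →
                           SameAtomsBelow F H k
    SameAtomsBelow-trans FG GH e e-atom ωe<k =
      let F→G , G→F = FG e e-atom ωe<k ; G→H , H→G = GH e e-atom ωe<k
      in G→H ∘ F→G , G→F ∘ H→G

    SameAtomsBelow-mono : ∀ {F G j k} → j ≤ℕ k → SameAtomsBelow F G k → SameAtomsBelow F G j
    SameAtomsBelow-mono j≤k FG e e-atom ωe<j = FG e e-atom (ℕ.<-≤-trans ωe<j j≤k)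

    infix 4 _≺_
    _≺_ : Rel (Elt L) 0ℓ
    F ≺ G = ∃[ c ] (Atom c × c ≤ F × ¬ c ≤ G × SameAtomsBelow F G (ω c))

    module _ (atomic : Atomic L) where

      label-exists : u ⋖ v → ∃ (Label u v)
      label-exists {u} {v} u⋖v with any? (newAtom? u v)
      ... | yes (_ , new) =
        let m , (m-atom , m≤v , m≰u) , minimal = argmin-exists (newAtom? u v) ω new
        in ω m , (m , m-atom , m≤v , m≰u , refl) , λ b b-atom b≤v b≰u → minimal b (b-atom , b≤v , b≰u)
      ... | no no-new = ⊥-elim (⋖⇒≢ u⋖v (≤-antisym (⋖⇒≤ u⋖v) (atomic v u below-u)))
        where
        below-u : ∀ a → Atom a → a ≤ v → a ≤ u
        below-u a a-atom a≤v = decidable-stable (a ≤? u) (λ a≰u → no-new (a , a-atom , a≤v , a≰u))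

      ascending-label-minimal : AscendingMiddle x z w → Label x w ℓ → ∀ e → NewAtom x z e → ℓ ≤ℕ ω e
      ascending-label-minimal {w = w} (_ , w⋖z , ascending , _) lab-xw e (e-atom , e≤z , e≰x)
        with label-exists w⋖z | e ≤? w
      ... | _ , _ | yes e≤w = proj₂ lab-xw e e-atom e≤w e≰x
      ... | _ , lab-wz | no e≰w = ℕ.≤-trans (ascending _ _ lab-xw lab-wz) (proj₂ lab-wz e e-atom e≤z e≰w)

      descent⇒ascendingMiddle-≺ : x ⋖ y → Descent x y z → AscendingMiddle x z w → w ≺ y
      descent⇒ascendingMiddle-≺ {x} {y} {w = w} x⋖y
        (ℓ₁ , _ , lab-xy , ((b , b-atom , b≤z , b≰y , refl) , _) , ωb<ℓ₁) middle@(x⋖w , _)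
        with label-exists x⋖w
      ... | _ , lab-xw@((c , c-atom , c≤w , c≰x , refl) , _) = c , c-atom , c≤w , c≰y , same-atoms
        where
        ωc<ℓ₁ : ω c < ℓ₁
        ωc<ℓ₁ = ℕ.≤-<-trans (ascending-label-minimal middle lab-xw b (b-atom , b≤z , b≰x)) ωb<ℓ₁
          where
          b≰x : ¬ b ≤ x
          b≰x b≤x = b≰y (≤-trans b≤x (⋖⇒≤ x⋖y))
        c≰y : ¬ c ≤ y
        c≰y c≤y = c≰x (below-label⇒≤ lab-xy c-atom ωc<ℓ₁ c≤y)
        same-atoms : SameAtomsBelow w y (ω c)
        same-atoms e e-atom ωe<ωc =
          (λ e≤w → ≤-trans (below-label⇒≤ lab-xw e-atom ωe<ωc e≤w) (⋖⇒≤ x⋖y)) ,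
          (λ e≤y → ≤-trans (below-label⇒≤ lab-xy e-atom (ℕ.<-trans ωe<ωc ωc<ℓ₁) e≤y) (⋖⇒≤ x⋖w))

      ascendingMiddle-unique : AtomOrder L ω → AscendingMiddle x z u → AscendingMiddle x z w → u ≡ w
      ascendingMiddle-unique {x} {u = u} {w} atomOrder u-middle@(x⋖u , u⋖z , _) w-middle@(x⋖w , w⋖z , _)
        with label-exists x⋖u | label-exists x⋖w
      ... | _ , lab-u@((c , c-atom , c≤u , c≰x , refl) , _)
          | _ , lab-w@((d , d-atom , d≤w , d≰x , refl) , _) =
        begin
          u      ≡⟨ sym (⋖-join x⋖u c≤u c≰x) ⟩
          x ∨ c  ≡⟨ cong (x ∨_) c≡d ⟩
          x ∨ d  ≡⟨ ⋖-join x⋖w d≤w d≰x ⟩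
          w      ∎
        where
        open ≡-Reasoning
        c≡d : c ≡ d
        c≡d = atomOrder c d c-atom d-atom (ℕ.≤-antisym
          (ascending-label-minimal u-middle lab-u d (d-atom , ≤-trans d≤w (⋖⇒≤ w⋖z) , d≰x))
          (ascending-label-minimal w-middle lab-w c (c-atom , ≤-trans c≤u (⋖⇒≤ u⋖z) , c≰x)))

    module _ (atomOrder : AtomOrder L ω) where

      ≺-trans : ∀ {F G H} → F ≺ G → G ≺ H → F ≺ H
      ≺-trans (c , c-atom , c≤F , c≰G , FG) (d , d-atom , d≤G , d≰H , GH) with ℕ.<-cmp (ω c) (ω d)
      ... | tri< ωc<ωd _ _ =
        c , c-atom , c≤F , c≰G ∘ proj₂ (GH c c-atom ωc<ωd) ,
        SameAtomsBelow-trans FG (SameAtomsBelow-mono (ℕ.<⇒≤ ωc<ωd) GH)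
      ... | tri≈ _ ωc≡ωd _ = ⊥-elim (c≰G (subst (_≤ _) (sym (atomOrder c d c-atom d-atom ωc≡ωd)) d≤G))
      ... | tri> _ _ ωd<ωc =
        d , d-atom , proj₂ (FG d d-atom ωd<ωc) d≤G , d≰H ,
        SameAtomsBelow-trans (SameAtomsBelow-mono (ℕ.<⇒≤ ωd<ωc) FG) GH

      ≺-isStrictPartialOrder : IsStrictPartialOrder _≡_ _≺_
      ≺-isStrictPartialOrder = record
        { isEquivalence = isEquivalence
        ; irrefl = λ { refl (_ , _ , c≤F , c≰F , _) → c≰F c≤F }
        ; trans = ≺-trans
        ; <-resp-≈ = resp₂ _≺_
        }

module DescentOrder (L : FinLattice) (geometric : Geometric L)
                    (ω : Elt L → ℕ) (atomOrder : AtomOrder L ω) where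
  open LatticeFacts L
  open Semimodularity (proj₂ geometric)
  open MinimalLabeling ω
  open Labeling L ω
  open PointwiseOrder (≺-isStrictPartialOrder atomOrder)

  private
    atomic : Atomic L
    atomic = proj₁ geometric
    variable M M' N : List (Elt L)

  record Replacement (M M' : List (Elt L)) : Set where
    field
      pre post  : List (Elt L)
      x y z w   : Elt L
      M≡        : M  ≡ (pre ∷ʳ x) ++ y ∷ z ∷ post
      M'≡       : M' ≡ (pre ∷ʳ x) ++ w ∷ z ∷ post
      w≺y       : w ≺ y
      ascending : AscendingMiddle x z w

  polygonMove⇒replacement : PolygonMove M M' → Replacement M M'
  polygonMove⇒replacement (chain , pre , post , x , y , z , C , refl , descent , C-chain , C-asc , refl) =
    replacement (SatChain-length-two x⋖y y⋖z C-chain)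
    where
    regroup : ∀ t → pre ++ x ∷ t ∷ z ∷ post ≡ (pre ∷ʳ x) ++ t ∷ z ∷ post
    regroup t = sym (++-assoc pre (x ∷ []) (t ∷ z ∷ post))
    x⋖y : x ⋖ y
    x⋖y = SatChain-⋖ pre chain
    y⋖z : y ⋖ z
    y⋖z = SatChain-⋖ (pre ∷ʳ x) (subst (SatChain L _ _) (regroup y) chain)
    replacement : ∃[ w ] (C ≡ x ∷ w ∷ z ∷ [] × x ⋖ w × w ⋖ z) → Replacement _ _
    replacement (w , refl , x⋖w , w⋖z) = record
      { pre = pre ; post = post ; x = x ; y = y ; z = z ; w = w
      ; M≡ = regroup y ; M'≡ = regroup w
      ; w≺y = descent⇒ascendingMiddle-≺ atomic x⋖y descent (x⋖w , w⋖z , C-asc)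
      ; ascending = x⋖w , w⋖z , C-asc
      }

  polygonMove⇒≤* : PolygonMove M M' → M' ≤* M
  polygonMove⇒≤* move with polygonMove⇒replacement move
  ... | record { pre = pre ; x = x ; M≡ = refl ; M'≡ = refl ; w≺y = w≺y } = replace-<⇒≤* (pre ∷ʳ x) w≺y

  polygonMove⇒≱* : PolygonMove M M' → ¬ M ≤* M'
  polygonMove⇒≱* move with polygonMove⇒replacement move
  ... | record { pre = pre ; x = x ; M≡ = refl ; M'≡ = refl ; w≺y = w≺y } = replace-<⇒≱* (pre ∷ʳ x) w≺y

  descentOrder⇒≤* : M' ≤D M → M' ≤* M
  descentOrder⇒≤* ε = ≤*-refl
  descentOrder⇒≤* (move ◅ moves) = ≤*-trans (descentOrder⇒≤* moves) (polygonMove⇒≤* move)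

  polygonMove-unique : PolygonMove M M' → PolygonMove M N → M' ≤* N → N ≡ M'
  polygonMove-unique move move' M'≤N with polygonMove⇒replacement move | polygonMove⇒replacement move'
  ... | record { pre = pre ; x = x ; M≡ = M≡ ; M'≡ = refl ; ascending = asc }
      | record { pre = pre' ; x = x' ; post = post ; z = z ; M≡ = M≡' ; M'≡ = refl ; w≺y = w'≺y' ; ascending = asc' }
      with replaced-position-unique (pre' ∷ʳ x') (pre ∷ʳ x) (trans (sym M≡') M≡) w'≺y' M'≤N
  ... | prefix≡ , refl , suffix≡ with ∷ʳ-injective pre' pre prefix≡ | ∷-injective suffix≡
  ... | refl , refl | refl , refl =
    cong (λ t → (pre ∷ʳ x) ++ t ∷ z ∷ post) (ascendingMiddle-unique atomic atomOrder asc' asc)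

  polygonMove⇒coveredBy : PolygonMove M M' → CoveredBy M' M
  polygonMove⇒coveredBy {M} {M'} move = (move ◅ ε , M'≢M) , nothing-between
    where
    M'≢M : M' ≢ M
    M'≢M refl = polygonMove⇒≱* move ≤*-refl
    nothing-between : ∀ N → MaxChain L N → M' <D N → N <D M → ⊥
    nothing-between N _ _ (ε , N≢M) = N≢M refl
    nothing-between N _ (N⇝M' , M'≢N) (_◅_ {j = N₁} move' N₁⇝N , _) = M'≢N (≤*-antisym M'≤N N≤M')
      where
      N₁≡M' : N₁ ≡ M'
      N₁≡M' = polygonMove-unique move move' (descentOrder⇒≤* (N₁⇝N ◅◅ N⇝M'))
      M'≤N : M' ≤* N
      M'≤N = descentOrder⇒≤* N⇝M'
      N≤M' : N ≤* M'
      N≤M' = subst (N ≤*_) N₁≡M' (descentOrder⇒≤* N₁⇝N)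

  coveredBy⇒polygonMove : CoveredBy M' M → PolygonMove M M'
  coveredBy⇒polygonMove ((ε , M'≢M) , _) = ⊥-elim (M'≢M refl)
  coveredBy⇒polygonMove ((move ◅ ε , _) , _) = move
  coveredBy⇒polygonMove {M'} {M} ((_◅_ {j = N} move (move' ◅ moves) , _) , nothing-between) =
    ⊥-elim (nothing-between N (proj₁ move') (move' ◅ moves , M'≢N) (move ◅ ε , N≢M))
    where
    M'≢N : M' ≢ N
    M'≢N refl = polygonMove⇒≱* move' (descentOrder⇒≤* moves)
    N≢M : N ≢ M
    N≢M refl = polygonMove⇒≱* move ≤*-refl

mainTheorem9 : (L : FinLattice) → Geometric L →
    (ω : Elt L → ℕ) → AtomOrder L ω →
    (M M' : List (Elt L)) → MaxChain L M → MaxChain L M' →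
    ((Labeling.PolygonMove L ω M M' → Labeling.CoveredBy L ω M' M)
     × (Labeling.CoveredBy L ω M' M → Labeling.PolygonMove L ω M M'))
mainTheorem9 L geometric ω atomOrder M M' _ _ = polygonMove⇒coveredBy , coveredBy⇒polygonMove
  where open DescentOrder L geometric ω atomOrder
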